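{- For every integer $n\ge 2$, $\pi_f(K'_{1,n})=\frac{4m-2}{3m-1}$, where $m=\lceil n/2\rceil$ and $K'_{1,n}$ is the graph obtained from the star $K_{1,n}$ by subdividing every edge exactly once.
   Context: Two edges are nonincident if they share no endpoint. A linear ordering of $V(G)$ separates a pair of nonincident edges if both endpoints of one edge precede both endpoints of the other. $\pi_t(G)$ is the minimum length of a list of linear orderings of $V(G)$ (repetitions allowed) separating every pair of nonincident edges at least $t$ times, and the fractional separation dimension is $\pi_f(G)=\liminf_{t\to\infty}\pi_t(G)/t$. -}

module Defs where

open import Data.Nat as ℕ using (ℕ; zero; suc; _+_; _*_; _∸_; ⌈_/2⌉)
open import Data.Fin as Fin using (Fin; _<?_)
open import Data.Fin.Permutation using (Permutation′; _⟨$⟩ʳ_)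
open import Data.Sum using (_⊎_; inj₁; inj₂)
open import Data.List using (List; []; _∷_; length)
open import Data.Product using (Σ; ∃; ∃-syntax; _×_; _,_)
open import Data.Integer using (+_)
open import Data.Rational as ℚ using (ℚ; 0ℚ; _/_; Positive)
open import Relation.Nullary using (¬_; Dec; yes; no)
open import Relation.Nullary.Decidable using (_×-dec_)
open import Relation.Binary.PropositionalEquality using (_≡_)

-- A (finite simple) graph on vertex set Fin N, given by a symmetric
-- edge relation (both orientations of an edge are present).
record Graph (N : ℕ) : Set₁ where
  field
    Edge : Fin N → Fin N → Set

open Graph public

-- A linear ordering of V(G) = Fin N: a bijection assigning each vertex its position.
Ordering : ℕ → Set
Ordering N = Permutation′ N

pos : ∀ {N} → Ordering N → Fin N → Fin N
pos σ v = σ ⟨$⟩ʳ v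

Precedes : ∀ {N} → Ordering N → (Fin N × Fin N) → (Fin N × Fin N) → Set
Precedes σ (u , v) (x , y) =
  (pos σ u Fin.< pos σ x × pos σ u Fin.< pos σ y) ×
  (pos σ v Fin.< pos σ x × pos σ v Fin.< pos σ y)

precedes? : ∀ {N} (σ : Ordering N) e f → Dec (Precedes σ e f)
precedes? σ (u , v) (x , y) =
  ((pos σ u <? pos σ x) ×-dec (pos σ u <? pos σ y)) ×-dec
  ((pos σ v <? pos σ x) ×-dec (pos σ v <? pos σ y))

separates? : ∀ {N} (σ : Ordering N) e f → Dec (Precedes σ e f ⊎ Precedes σ f e)
separates? σ e f with precedes? σ e f | precedes? σ f e
... | yes p | _ = yes (inj₁ p)
... | no ¬p | yes q = yes (inj₂ q)
... | no ¬p | no ¬q = no (λ { (inj₁ p) → ¬p p ; (inj₂ q) → ¬q q })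

sepCount : ∀ {N} → List (Ordering N) → (Fin N × Fin N) → (Fin N × Fin N) → ℕ
sepCount [] e f = 0
sepCount (σ ∷ L) e f with separates? σ e f
... | yes _ = suc (sepCount L e f)
... | no _  = sepCount L e f

Nonincident : ∀ {N} → (Fin N × Fin N) → (Fin N × Fin N) → Set
Nonincident (u , v) (x , y) = ¬ u ≡ x × ¬ u ≡ y × ¬ v ≡ x × ¬ v ≡ y

SeparatesAll : ∀ {N} → Graph N → List (Ordering N) → ℕ → Set
SeparatesAll {N} G L t =
  ∀ (u v x y : Fin N) → Edge G u v → Edge G x y → Nonincident (u , v) (x , y) →
  t ℕ.≤ sepCount L (u , v) (x , y)

IsPiT : ∀ {N} → Graph N → ℕ → ℕ → Set
IsPiT {N} G t k =
  (Σ (List (Ordering N)) λ L → length L ≡ k × SeparatesAll G L t) ×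
  (∀ (L : List (Ordering N)) → SeparatesAll G L t → k ℕ.≤ length L)

-- the rational a/b (with the convention a/0 = 0; only used with b ≥ 1)
ratio : ℕ → ℕ → ℚ
ratio a zero = 0ℚ
ratio a (suc b) = (+ a) / suc b

-- π_f(G) = liminf_{t→∞} π_t(G)/t equals q, unfolded:
--  (i) for every ε > 0, eventually π_t(G)/t > q - ε;
--  (ii) for every ε > 0, π_t(G)/t < q + ε for infinitely many t.
FracSepDimIs : ∀ {N} → Graph N → ℚ → Set
FracSepDimIs G q =
  (∀ (ε : ℚ) → Positive ε → ∃[ T ] ∀ (t k : ℕ) → T ℕ.≤ t → 1 ℕ.≤ t → IsPiT G t k →
      q ℚ.- ε ℚ.< ratio k t) ×
  (∀ (ε : ℚ) → Positive ε → ∀ (T : ℕ) → ∃[ t ] ∃[ k ] (T ℕ.≤ t × 1 ℕ.≤ t × IsPiT G t k ×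
      ratio k t ℚ.< q ℚ.+ ε))

-- K'_{1,n}: vertices Fin (1 + n + n); 0 is the centre, mid i = 1 + i, leaf i = 1 + n + i.
mid : ∀ {n} → Fin n → Fin (suc (n + n))
mid {n} i = Fin.suc (i Fin.↑ˡ n)

leaf : ∀ {n} → Fin n → Fin (suc (n + n))
leaf {n} i = Fin.suc (n Fin.↑ʳ i)

data SubStarEdge (n : ℕ) : Fin (suc (n + n)) → Fin (suc (n + n)) → Set where
  cm : ∀ i → SubStarEdge n Fin.zero (mid {n} i)
  mc : ∀ i → SubStarEdge n (mid {n} i) Fin.zero
  ml : ∀ i → SubStarEdge n (mid {n} i) (leaf {n} i)
  lm : ∀ i → SubStarEdge n (leaf {n} i) (mid {n} i)

SubdividedStar : (n : ℕ) → Graph (suc (n + n))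
SubdividedStar n = record { Edge = SubStarEdge n }

module Submission where

-- Write c for the centre, mᵢ for the subdivision vertices and lᵢ for the leaves, and m = ⌈n/2⌉.
--
-- If an ordering separates cmᵢ from mⱼlⱼ, then mⱼ is the first or the last of c, mᵢ, mⱼ;
-- both mᵢ and mⱼ are extreme only when c lies between them. So among the n(n - 1) ordered pairs
-- (i, j), i ≠ j, an ordering separates at most n(n - 1)/2 + ab ≤ n(n - 1)/2 + ⌊n/2⌋⌈n/2⌉, where a and b
-- count the mᵢ before and after c, while a list separating all pairs t times separates them
-- t·n(n - 1) times in total; this rearranges to (4m - 2) t ≤ (3m - 1) · length.
--
-- A word with m letters true and m false gives the ordering that lists the branches
-- with a true letter before c (leaf first) and the others after c (mid first), each group by index.
-- It separates any two outer edges, and separates cmᵢ from mⱼlⱼ unless i < j and both letters are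
-- true, or i > j and both are false, which happens for C(2m - 2, m - 2) of the C(2m, m) words.
-- Since (3m - 1) C(2m, m) = (4m - 2) (C(2m, m) - C(2m - 2, m - 2)), copies of this family attain
-- the lower bound.

open import Defs
open import Data.Nat
  using (ℕ; zero; suc; _+_; _*_; _∸_; _≤_; _<_; z≤n; s≤s; _<?_; _≟_; ⌊_/2⌋; ⌈_/2⌉)
import Data.Nat.Properties as ℕₚ
open import Data.Nat.Tactic.RingSolver using (solve-∀)
open import Data.Fin as Fin using (Fin; toℕ)
import Data.Fin.Properties as Finₚ
open import Data.Bool using (Bool; true; false; _∧_; not; if_then_else_)
open import Data.List using (List; []; _∷_; length; _++_; map)
import Data.List.Properties as Listₚ
open import Data.Product using (∃; ∃-syntax; _×_; _,_; proj₁; proj₂)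
open import Data.Sum using (_⊎_; inj₁; inj₂)
open import Data.Empty using (⊥-elim)
open import Data.Integer as ℤ using ()
import Data.Integer.Properties as ℤₚ
open import Data.Rational as ℚ using (Positive)
import Data.Rational.Properties as ℚₚ
open import Data.Rational.Unnormalised using (mkℚᵘ; *≤*)
import Data.Rational.Unnormalised.Properties as ℚᵘₚ
open import Function using (_∘_)
open import Function.Definitions using (Injective)
open import Data.Fin.Permutation using (permutation; _⟨$⟩ˡ_; inverseˡ)
open import Relation.Nullary using (¬_; Dec; yes; no; does)
open import Relation.Nullary.Decidable using (_×-dec_; ¬?)
open import Relation.Binary.Definitions using (tri<; tri≈; tri>)
open import Relation.Binary.PropositionalEquality
  using (_≡_; _≢_; refl; sym; trans; cong; cong₂; subst; subst₂; module ≡-Reasoning)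
open import Algebra.Properties.Semiring.Sum ℕₚ.+-*-semiring
  using (sum; sum-syntax; sum-cong-≗; ∑-distrib-+; ∑-comm; *-distribˡ-sum; *-distribʳ-sum)

private variable
  P Q R : Set

bit : Bool → ℕ
bit true  = 1
bit false = 0

𝟙 : Dec P → ℕ
𝟙 d = bit (does d)

𝟙-yes : (d : Dec P) → P → 𝟙 d ≡ 1
𝟙-yes (yes _) _ = refl
𝟙-yes (no ¬p) p = ⊥-elim (¬p p)

𝟙-no : (d : Dec P) → ¬ P → 𝟙 d ≡ 0
𝟙-no (yes p) ¬p = ⊥-elim (¬p p)
𝟙-no (no _)  _  = refl

𝟙≤1 : (d : Dec P) → 𝟙 d ≤ 1
𝟙≤1 (yes _) = s≤s z≤n
𝟙≤1 (no _)  = z≤n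

𝟙-mono : (d : Dec P) (e : Dec Q) → (P → Q) → 𝟙 d ≤ 𝟙 e
𝟙-mono (yes p) e f = ℕₚ.≤-reflexive (sym (𝟙-yes e (f p)))
𝟙-mono (no _)  e f = z≤n

𝟙-× : (d : Dec P) (e : Dec Q) → 𝟙 (d ×-dec e) ≡ 𝟙 d * 𝟙 e
𝟙-× (yes _) (yes _) = refl
𝟙-× (yes _) (no _)  = refl
𝟙-× (no _)  _       = refl

𝟙-⊎ : (d : Dec P) (e : Dec Q) (f : Dec R) → (P → Q ⊎ R) → 𝟙 d ≤ 𝟙 e + 𝟙 f
𝟙-⊎ (no _)  e f h = z≤n
𝟙-⊎ (yes p) e f h with h p
... | inj₁ q rewrite 𝟙-yes e q = s≤s z≤n
... | inj₂ r rewrite 𝟙-yes f r = ℕₚ.m≤n+m 1 (𝟙 e)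

𝟙-¬ : (d : Dec P) → 𝟙 d + 𝟙 (¬? d) ≡ 1
𝟙-¬ (yes _) = refl
𝟙-¬ (no _)  = refl

∑-mono : ∀ {n} {f g : Fin n → ℕ} → (∀ i → f i ≤ g i) → sum f ≤ sum g
∑-mono {zero}  h = z≤n
∑-mono {suc n} h = ℕₚ.+-mono-≤ (h Fin.zero) (∑-mono (h ∘ Fin.suc))

∑-const : ∀ n c → ∑[ i < n ] c ≡ n * c
∑-const zero    c = refl
∑-const (suc n) c = cong (c +_) (∑-const n c)

∑-cong : ∀ {n} {f g : Fin n → ℕ} → (∀ i → f i ≡ g i) → sum f ≡ sum g
∑-cong = sum-cong-≗

∑-zero : ∀ n → ∑[ i < n ] 0 ≡ 0
∑-zero n = trans (∑-const n 0) (ℕₚ.*-zeroʳ n)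

∑-δ : ∀ {n} (i : Fin n) → ∑[ j < n ] 𝟙 (i Finₚ.≟ j) ≡ 1
∑-δ {suc n} Fin.zero    = cong suc (∑-zero n)
∑-δ {suc n} (Fin.suc i) = ∑-δ i

∑∑-mono : ∀ {a b} {f g : Fin a → Fin b → ℕ} → (∀ i j → f i j ≤ g i j) →
  ∑[ i < a ] ∑[ j < b ] f i j ≤ ∑[ i < a ] ∑[ j < b ] g i j
∑∑-mono h = ∑-mono (λ i → ∑-mono (h i))

∑∑-distrib-+ : ∀ {a b} (f g : Fin a → Fin b → ℕ) →
  ∑[ i < a ] ∑[ j < b ] (f i j + g i j) ≡ ∑[ i < a ] ∑[ j < b ] f i j + ∑[ i < a ] ∑[ j < b ] g i j
∑∑-distrib-+ f g = trans (∑-cong (λ i → ∑-distrib-+ (f i) (g i)))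
  (∑-distrib-+ (λ i → ∑[ j < _ ] f i j) (λ i → ∑[ j < _ ] g i j))

*-distribˡ-∑∑ : ∀ {a b} c (f : Fin a → Fin b → ℕ) →
  c * ∑[ i < a ] ∑[ j < b ] f i j ≡ ∑[ i < a ] ∑[ j < b ] (c * f i j)
*-distribˡ-∑∑ c f = trans (*-distribˡ-sum c (λ i → ∑[ j < _ ] f i j)) (∑-cong (λ i → *-distribˡ-sum c (f i)))

count : ∀ {A : Set} → (A → Bool) → List A → ℕ
count p []       = 0
count p (x ∷ xs) = bit (p x) + count p xs

module _ {A : Set} where

  count-++ : ∀ (p : A → Bool) xs ys → count p (xs ++ ys) ≡ count p xs + count p ys
  count-++ p []       ys = refl
  count-++ p (x ∷ xs) ys = trans (cong (bit (p x) +_) (count-++ p xs ys)) (sym (ℕₚ.+-assoc (bit (p x)) _ _))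

  count-map : ∀ {B : Set} (p : B → Bool) (f : A → B) xs → count p (map f xs) ≡ count (p ∘ f) xs
  count-map p f []       = refl
  count-map p f (x ∷ xs) = cong (bit (p (f x)) +_) (count-map p f xs)

  count-true : ∀ (xs : List A) → count (λ _ → true) xs ≡ length xs
  count-true []       = refl
  count-true (x ∷ xs) = cong suc (count-true xs)

  count-false : ∀ (xs : List A) → count (λ _ → false) xs ≡ 0
  count-false []       = refl
  count-false (x ∷ xs) = count-false xs

  count-inclusion-exclusion : ∀ (p q r s : A → Bool) → (∀ x → bit (p x) + bit (q x) + bit (r x) ≡ 1 + bit (s x)) →
    ∀ xs → count p xs + count q xs + count r xs ≡ length xs + count s xs
  count-inclusion-exclusion p q r s h []       = refl
  count-inclusion-exclusion p q r s h (x ∷ xs) = begin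
    bit (p x) + count p xs + (bit (q x) + count q xs) + (bit (r x) + count r xs)
      ≡⟨ regroup (bit (p x)) (bit (q x)) (bit (r x)) (count p xs) (count q xs) (count r xs) ⟩
    (bit (p x) + bit (q x) + bit (r x)) + (count p xs + count q xs + count r xs)
      ≡⟨ cong₂ _+_ (h x) (count-inclusion-exclusion p q r s h xs) ⟩
    1 + bit (s x) + (length xs + count s xs)
      ≡⟨ regroup′ (bit (s x)) (length xs) (count s xs) ⟩
    suc (length xs) + (bit (s x) + count s xs) ∎
    where
    open ≡-Reasoning
    regroup : ∀ a b c d e f → a + d + (b + e) + (c + f) ≡ (a + b + c) + (d + e + f)
    regroup = solve-∀
    regroup′ : ∀ a l c → 1 + a + (l + c) ≡ suc l + (a + c)
    regroup′ = solve-∀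

Separated : ∀ {N} → Ordering N → Fin N × Fin N → Fin N × Fin N → Set
Separated σ e f = Precedes σ e f ⊎ Precedes σ f e

module _ {N : ℕ} (σ : Ordering N) where

  separated-sym : ∀ {e f} → Separated σ e f → Separated σ f e
  separated-sym (inj₁ p) = inj₂ p
  separated-sym (inj₂ p) = inj₁ p

  separated-flipˡ : ∀ {u v x y} → Separated σ (u , v) (x , y) → Separated σ (v , u) (x , y)
  separated-flipˡ (inj₁ (p , q))             = inj₁ (q , p)
  separated-flipˡ (inj₂ ((p , q) , (r , s))) = inj₂ ((q , p) , (s , r))

  separated-flipʳ : ∀ {u v x y} → Separated σ (u , v) (x , y) → Separated σ (u , v) (y , x)
  separated-flipʳ = separated-sym ∘ separated-flipˡ ∘ separated-sym

module _ {N : ℕ} where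

  sepCount-∷ : ∀ σ (L : List (Ordering N)) e f →
    sepCount (σ ∷ L) e f ≡ 𝟙 (separates? σ e f) + sepCount L e f
  sepCount-∷ σ L e f with separates? σ e f
  ... | yes _ = refl
  ... | no _  = refl

  sepCount-mono : ∀ (L : List (Ordering N)) {e f e′ f′} →
    (∀ σ → Separated σ e f → Separated σ e′ f′) → sepCount L e f ≤ sepCount L e′ f′
  sepCount-mono []      h = z≤n
  sepCount-mono (σ ∷ L) {e} {f} {e′} {f′} h =
    subst₂ _≤_ (sym (sepCount-∷ σ L e f)) (sym (sepCount-∷ σ L e′ f′))
      (ℕₚ.+-mono-≤ (𝟙-mono (separates? σ e f) (separates? σ e′ f′) (h σ)) (sepCount-mono L h))

  sepCount-++ : ∀ (L M : List (Ordering N)) e f → sepCount (L ++ M) e f ≡ sepCount L e f + sepCount M e f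
  sepCount-++ []      M e f = refl
  sepCount-++ (σ ∷ L) M e f = begin
    sepCount (σ ∷ L ++ M) e f                 ≡⟨ sepCount-∷ σ (L ++ M) e f ⟩
    s + sepCount (L ++ M) e f                 ≡⟨ cong (s +_) (sepCount-++ L M e f) ⟩
    s + (sepCount L e f + sepCount M e f)     ≡⟨ ℕₚ.+-assoc s (sepCount L e f) (sepCount M e f) ⟨
    s + sepCount L e f + sepCount M e f       ≡⟨ cong (_+ sepCount M e f) (sepCount-∷ σ L e f) ⟨
    sepCount (σ ∷ L) e f + sepCount M e f     ∎
    where
    open ≡-Reasoning
    s : ℕ
    s = 𝟙 (separates? σ e f)

  sepCount-∷-≥ : ∀ σ (L : List (Ordering N)) e f → sepCount L e f ≤ sepCount (σ ∷ L) e f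
  sepCount-∷-≥ σ L e f = subst (sepCount L e f ≤_) (sym (sepCount-∷ σ L e f)) (ℕₚ.m≤n+m _ _)

  sepCount-map-≥ : ∀ {A : Set} (ord : A → Ordering N) (p : A → Bool) {e f} →
    (∀ x → p x ≡ false → Separated (ord x) e f) →
    ∀ xs → length xs ≤ count p xs + sepCount (map ord xs) e f
  sepCount-map-≥ ord p h []       = z≤n
  sepCount-map-≥ ord p {e} {f} h (x ∷ xs) with p x in px
  ... | true  = s≤s (ℕₚ.≤-trans (sepCount-map-≥ ord p h xs)
                       (ℕₚ.+-monoʳ-≤ (count p xs) (sepCount-∷-≥ (ord x) (map ord xs) e f)))
  ... | false = begin
    suc (length xs)                                ≤⟨ s≤s (sepCount-map-≥ ord p h xs) ⟩
    suc (count p xs + sepCount (map ord xs) e f)   ≡⟨ ℕₚ.+-suc (count p xs) _ ⟨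
    count p xs + suc (sepCount (map ord xs) e f)   ≡⟨ cong (count p xs +_) separatedByX ⟨
    count p xs + sepCount (map ord (x ∷ xs)) e f   ∎
    where
    open ℕₚ.≤-Reasoning
    separatedByX : sepCount (ord x ∷ map ord xs) e f ≡ suc (sepCount (map ord xs) e f)
    separatedByX = trans (sepCount-∷ (ord x) (map ord xs) e f)
      (cong (_+ sepCount (map ord xs) e f) (𝟙-yes (separates? (ord x) e f) (h x px)))

module _ {N a b : ℕ} (e f : Fin a → Fin b → Fin N × Fin N) where

  separationsIn : Ordering N → ℕ
  separationsIn σ = ∑[ i < a ] ∑[ j < b ] 𝟙 (separates? σ (e i j) (f i j))

  totalSepCount : List (Ordering N) → ℕ
  totalSepCount L = ∑[ i < a ] ∑[ j < b ] sepCount L (e i j) (f i j)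

  totalSepCount-∷ : ∀ σ L → totalSepCount (σ ∷ L) ≡ separationsIn σ + totalSepCount L
  totalSepCount-∷ σ L = begin
    totalSepCount (σ ∷ L)                          ≡⟨ ∑-cong (λ i → ∑-cong (λ j → sepCount-∷ σ L (e i j) (f i j))) ⟩
    ∑[ i < a ] ∑[ j < b ] (sep i j + counted i j)    ≡⟨ ∑-cong (λ i → ∑-distrib-+ (sep i) (counted i)) ⟩
    ∑[ i < a ] (∑[ j < b ] sep i j + ∑[ j < b ] counted i j)
      ≡⟨ ∑-distrib-+ (λ i → ∑[ j < b ] sep i j) (λ i → ∑[ j < b ] counted i j) ⟩
    separationsIn σ + totalSepCount L              ∎
    where
    open ≡-Reasoning
    sep counted : Fin a → Fin b → ℕ
    sep i j = 𝟙 (separates? σ (e i j) (f i j))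
    counted i j = sepCount L (e i j) (f i j)

  totalSepCount-[] : totalSepCount [] ≡ 0
  totalSepCount-[] = trans (∑-cong {a} {g = λ _ → 0} (λ _ → ∑-zero b)) (∑-zero a)

  totalSepCount-bound : ∀ c M → (∀ σ → c * separationsIn σ ≤ M) →
    ∀ L → c * totalSepCount L ≤ length L * M
  totalSepCount-bound c M h [] = ℕₚ.≤-reflexive (trans (cong (c *_) totalSepCount-[]) (ℕₚ.*-zeroʳ c))
  totalSepCount-bound c M h (σ ∷ L) = begin
    c * totalSepCount (σ ∷ L)                   ≡⟨ cong (c *_) (totalSepCount-∷ σ L) ⟩
    c * (separationsIn σ + totalSepCount L)     ≡⟨ ℕₚ.*-distribˡ-+ c _ _ ⟩
    c * separationsIn σ + c * totalSepCount L   ≤⟨ ℕₚ.+-mono-≤ (h σ) (totalSepCount-bound c M h L) ⟩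
    M + length L * M                            ∎
    where open ℕₚ.≤-Reasoning

-- Orderings sorted by a key

pos-injective : ∀ {N} (σ : Ordering N) → Injective _≡_ _≡_ (pos σ)
pos-injective σ e = trans (sym (inverseˡ σ)) (trans (cong (σ ⟨$⟩ˡ_) e) (inverseˡ σ))

injective⇒surjective : ∀ {M} (f : Fin M → Fin M) → Injective _≡_ _≡_ f → ∀ y → ∃ λ x → f x ≡ y
injective⇒surjective {suc M} f f-inj y with Finₚ.any? (λ x → f x Finₚ.≟ y)
... | yes found = found
... | no ¬found = ⊥-elim (ℕₚ.<-irrefl refl (Finₚ.injective⇒≤ g-inj))
  where
  g : Fin (suc M) → Fin M
  g x = Fin.punchOut {i = y} {j = f x} (λ e → ¬found (x , sym e))
  g-inj : Injective _≡_ _≡_ g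
  g-inj {a} {b} e = f-inj (Finₚ.punchOut-injective (λ e → ¬found (a , sym e)) (λ e → ¬found (b , sym e)) e)

orderingFromInjection : ∀ {M} (f : Fin M → Fin M) → Injective _≡_ _≡_ f → Ordering M
orderingFromInjection f f-inj = permutation f (proj₁ ∘ surj) (proj₂ ∘ surj) (λ x → f-inj (proj₂ (surj (f x))))
  where surj = injective⇒surjective f f-inj

module _ {N : ℕ} (h : Fin N → ℕ) where

  rank : Fin N → ℕ
  rank v = ∑[ u < N ] 𝟙 (h u <? h v)

  suc-rank : ∀ v → suc (rank v) ≡ ∑[ u < N ] (𝟙 (h u <? h v) + 𝟙 (v Finₚ.≟ u))
  suc-rank v = sym (begin
    ∑[ u < N ] (𝟙 (h u <? h v) + 𝟙 (v Finₚ.≟ u))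
      ≡⟨ ∑-distrib-+ (λ u → 𝟙 (h u <? h v)) (λ u → 𝟙 (v Finₚ.≟ u)) ⟩
    rank v + ∑[ u < N ] 𝟙 (v Finₚ.≟ u)           ≡⟨ cong (rank v +_) (∑-δ v) ⟩
    rank v + 1                                   ≡⟨ ℕₚ.+-comm (rank v) 1 ⟩
    suc (rank v)                                 ∎)
    where open ≡-Reasoning

  rank<N : ∀ v → rank v < N
  rank<N v = begin
    suc (rank v)                                 ≡⟨ suc-rank v ⟩
    ∑[ u < N ] (𝟙 (h u <? h v) + 𝟙 (v Finₚ.≟ u)) ≤⟨ ∑-mono atMostOne ⟩
    ∑[ u < N ] 1                                 ≡⟨ ∑-const N 1 ⟩
    N * 1                                        ≡⟨ ℕₚ.*-identityʳ N ⟩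
    N                                            ∎
    where
    open ℕₚ.≤-Reasoning
    atMostOne : ∀ u → 𝟙 (h u <? h v) + 𝟙 (v Finₚ.≟ u) ≤ 1
    atMostOne u with v Finₚ.≟ u
    ... | yes refl = ℕₚ.≤-reflexive (cong (_+ 1) (𝟙-no (h v <? h v) (ℕₚ.<-irrefl refl)))
    ... | no _     = ℕₚ.≤-trans (ℕₚ.≤-reflexive (ℕₚ.+-identityʳ _)) (𝟙≤1 (h u <? h v))

  rank-mono : ∀ {v w} → h v < h w → rank v < rank w
  rank-mono {v} {w} hv<hw = begin
    suc (rank v)                                 ≡⟨ suc-rank v ⟩
    ∑[ u < N ] (𝟙 (h u <? h v) + 𝟙 (v Finₚ.≟ u)) ≤⟨ ∑-mono below ⟩
    rank w                                       ∎
    where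
    open ℕₚ.≤-Reasoning
    below : ∀ u → 𝟙 (h u <? h v) + 𝟙 (v Finₚ.≟ u) ≤ 𝟙 (h u <? h w)
    below u with v Finₚ.≟ u
    ... | yes refl = ℕₚ.≤-reflexive (cong₂ _+_ (𝟙-no (h v <? h v) (ℕₚ.<-irrefl refl)) (sym (𝟙-yes (h v <? h w) hv<hw)))
    ... | no _     = ℕₚ.≤-trans (ℕₚ.≤-reflexive (ℕₚ.+-identityʳ _))
                       (𝟙-mono (h u <? h v) (h u <? h w) (λ hu<hv → ℕₚ.<-trans hu<hv hv<hw))

module _ {N : ℕ} (key : Fin N → ℕ) where

  refinedKey : Fin N → ℕ
  refinedKey v = key v * N + toℕ v

  refinedKey-mono : ∀ {v w} → key v < key w → refinedKey v < refinedKey w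
  refinedKey-mono {v} {w} kv<kw = begin-strict
    key v * N + toℕ v  <⟨ ℕₚ.+-monoʳ-< (key v * N) (Finₚ.toℕ<n v) ⟩
    key v * N + N      ≡⟨ ℕₚ.+-comm (key v * N) N ⟩
    suc (key v) * N    ≤⟨ ℕₚ.*-monoˡ-≤ N kv<kw ⟩
    key w * N          ≤⟨ ℕₚ.m≤m+n (key w * N) (toℕ w) ⟩
    refinedKey w       ∎
    where open ℕₚ.≤-Reasoning

  refinedKey-injective : Injective _≡_ _≡_ refinedKey
  refinedKey-injective {v} {w} e with ℕₚ.<-cmp (key v) (key w)
  ... | tri< kv<kw _ _ = ⊥-elim (ℕₚ.<-irrefl e (refinedKey-mono kv<kw))
  ... | tri> _ _ kw<kv = ⊥-elim (ℕₚ.<-irrefl (sym e) (refinedKey-mono kw<kv))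
  ... | tri≈ _ kv≡kw _ = Finₚ.toℕ-injective
          (ℕₚ.+-cancelˡ-≡ (key v * N) _ _ (trans e (cong (λ k → k * N + toℕ w) (sym kv≡kw))))

  positionIn : Fin N → Fin N
  positionIn v = Fin.fromℕ< (rank<N refinedKey v)

  positionIn-mono : ∀ {v w} → refinedKey v < refinedKey w → toℕ (positionIn v) < toℕ (positionIn w)
  positionIn-mono {v} {w} lt = subst₂ _<_ (sym (Finₚ.toℕ-fromℕ< (rank<N refinedKey v)))
    (sym (Finₚ.toℕ-fromℕ< (rank<N refinedKey w))) (rank-mono refinedKey lt)

  positionIn-injective : Injective _≡_ _≡_ positionIn
  positionIn-injective {v} {w} e with ℕₚ.<-cmp (refinedKey v) (refinedKey w)
  ... | tri< lt _ _ = ⊥-elim (ℕₚ.<-irrefl (cong toℕ e) (positionIn-mono lt))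
  ... | tri≈ _ eq _ = refinedKey-injective eq
  ... | tri> _ _ gt = ⊥-elim (ℕₚ.<-irrefl (cong toℕ (sym e)) (positionIn-mono gt))

  sortedBy : Ordering N
  sortedBy = orderingFromInjection positionIn positionIn-injective

  sortedBy-mono : ∀ {v w} → key v < key w → pos sortedBy v Fin.< pos sortedBy w
  sortedBy-mono = positionIn-mono ∘ refinedKey-mono

module Branches (n : ℕ) where

  private
    N : ℕ
    N = suc (n + n)

  mid-injective : Injective _≡_ _≡_ (mid {n})
  mid-injective {i} {j} e = Finₚ.↑ˡ-injective n i j (Finₚ.suc-injective e)

  mid≢leaf : ∀ (i j : Fin n) → mid {n} i ≢ leaf j
  mid≢leaf i j e = ℕₚ.<-irrefl i≡n+j (ℕₚ.<-≤-trans (Finₚ.toℕ<n i) (ℕₚ.m≤m+n n (toℕ j)))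
    where
    i≡n+j : toℕ i ≡ n + toℕ j
    i≡n+j = trans (sym (Finₚ.toℕ-↑ˡ i n)) (trans (cong toℕ (Finₚ.suc-injective e)) (Finₚ.toℕ-↑ʳ n j))

  centreEdge outerEdge : Fin n → Fin N × Fin N
  centreEdge i = Fin.zero , mid i
  outerEdge  j = mid j , leaf j

  centre-outer-nonincident : ∀ {i j} → i ≢ j → Nonincident (centreEdge i) (outerEdge j)
  centre-outer-nonincident {i} {j} i≢j = (λ ()) , (λ ()) , i≢j ∘ mid-injective , mid≢leaf i j

  module _ (L : List (Ordering N)) (t : ℕ) where

    Covered : Fin N × Fin N → Fin N × Fin N → Set
    Covered e f = t ≤ sepCount L e f

    private
      swap : ∀ {e f} → Covered e f → Covered f e
      swap c = ℕₚ.≤-trans c (sepCount-mono L (λ σ → separated-sym σ))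
      flipˡ : ∀ {u v x y} → Covered (u , v) (x , y) → Covered (v , u) (x , y)
      flipˡ c = ℕₚ.≤-trans c (sepCount-mono L (λ σ → separated-flipˡ σ))
      flipʳ : ∀ {u v x y} → Covered (u , v) (x , y) → Covered (u , v) (y , x)
      flipʳ c = ℕₚ.≤-trans c (sepCount-mono L (λ σ → separated-flipʳ σ))

    separatesAll-fromBranches :
      (∀ {i j} → i ≢ j → Covered (centreEdge i) (outerEdge j)) →
      (∀ {i j} → i ≢ j → Covered (outerEdge i) (outerEdge j)) →
      SeparatesAll (SubdividedStar n) L t
    separatesAll-fromBranches cen out = cover
      where
      ≢ʳ : ∀ {i j} → mid {n} i ≢ mid j → j ≢ i
      ≢ʳ ne = ne ∘ cong mid ∘ sym
      cover : SeparatesAll (SubdividedStar n) L t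
      cover _ _ _ _ (cm i) (cm j) (0≢0 , _) = ⊥-elim (0≢0 refl)
      cover _ _ _ _ (cm i) (mc j) (_ , 0≢0 , _) = ⊥-elim (0≢0 refl)
      cover _ _ _ _ (cm i) (ml j) (_ , _ , ne , _) = cen (ne ∘ cong mid)
      cover _ _ _ _ (cm i) (lm j) (_ , _ , _ , ne) = flipʳ (cen (ne ∘ cong mid))
      cover _ _ _ _ (mc i) (cm j) (_ , _ , 0≢0 , _) = ⊥-elim (0≢0 refl)
      cover _ _ _ _ (mc i) (mc j) (_ , _ , _ , 0≢0) = ⊥-elim (0≢0 refl)
      cover _ _ _ _ (mc i) (ml j) (ne , _) = flipˡ (cen (ne ∘ cong mid))
      cover _ _ _ _ (mc i) (lm j) (_ , ne , _) = flipˡ (flipʳ (cen (ne ∘ cong mid)))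
      cover _ _ _ _ (ml i) (cm j) (_ , ne , _) = swap (cen (≢ʳ ne))
      cover _ _ _ _ (ml i) (mc j) (ne , _) = swap (flipˡ (cen (≢ʳ ne)))
      cover _ _ _ _ (ml i) (ml j) (ne , _) = out (ne ∘ cong mid)
      cover _ _ _ _ (ml i) (lm j) (_ , ne , _) = flipʳ (out (ne ∘ cong mid))
      cover _ _ _ _ (lm i) (cm j) (_ , _ , _ , ne) = flipˡ (swap (cen (≢ʳ ne)))
      cover _ _ _ _ (lm i) (mc j) (_ , _ , ne , _) = flipˡ (swap (flipˡ (cen (≢ʳ ne))))
      cover _ _ _ _ (lm i) (ml j) (_ , _ , ne , _) = flipˡ (out (ne ∘ cong mid))
      cover _ _ _ _ (lm i) (lm j) (_ , _ , _ , ne) = flipˡ (flipʳ (out (ne ∘ cong mid)))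

-- The lower bound

𝟙<-yes : ∀ {a b} → a < b → 𝟙 (a <? b) ≡ 1
𝟙<-yes {a} {b} = 𝟙-yes (a <? b)

𝟙<-no : ∀ {a b} → b ≤ a → 𝟙 (a <? b) ≡ 0
𝟙<-no {a} {b} b≤a = 𝟙-no (a <? b) (ℕₚ.≤⇒≯ b≤a)

extreme : ℕ → ℕ → ℕ → ℕ
extreme x y z = 𝟙 (z <? y) * 𝟙 (x <? y) + 𝟙 (y <? z) * 𝟙 (y <? x)

between : ℕ → ℕ → ℕ → ℕ
between x z y = 𝟙 (x <? z) * 𝟙 (z <? y)

-- Of three distinct numbers exactly two are extreme, and x, y both are iff z lies between them.
extreme-pair-< : ∀ {x y z} → x < y → z ≢ x → z ≢ y →
  extreme x y z + extreme y x z ≤ 1 + (between x z y + between y z x)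
extreme-pair-< {x} {y} {z} x<y z≢x z≢y with ℕₚ.<-cmp z x
... | tri≈ _ z≡x _ = ⊥-elim (z≢x z≡x)
... | tri< z<x _ _
  rewrite 𝟙<-yes z<x | 𝟙<-yes (ℕₚ.<-trans z<x x<y) | 𝟙<-yes x<y
        | 𝟙<-no (ℕₚ.<⇒≤ (ℕₚ.<-trans z<x x<y)) | 𝟙<-no (ℕₚ.<⇒≤ z<x) | 𝟙<-no (ℕₚ.<⇒≤ x<y) = s≤s z≤n
... | tri> _ _ x<z with ℕₚ.<-cmp z y
...   | tri≈ _ z≡y _ = ⊥-elim (z≢y z≡y)
...   | tri< z<y _ _
  rewrite 𝟙<-yes z<y | 𝟙<-yes x<y | 𝟙<-yes x<z | 𝟙<-no (ℕₚ.<⇒≤ z<y) | 𝟙<-no (ℕₚ.<⇒≤ x<z) = ℕₚ.≤-refl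
...   | tri> _ _ y<z
  rewrite 𝟙<-yes y<z | 𝟙<-yes x<y | 𝟙<-yes (ℕₚ.<-trans x<y y<z)
        | 𝟙<-no (ℕₚ.<⇒≤ y<z) | 𝟙<-no (ℕₚ.<⇒≤ (ℕₚ.<-trans x<y y<z)) | 𝟙<-no (ℕₚ.<⇒≤ x<y) = s≤s z≤n

extreme-pair : ∀ x y {z} → x ≢ z → y ≢ z →
  extreme x y z + extreme y x z ≤ 𝟙 (¬? (x ≟ y)) + (between x z y + between y z x)
extreme-pair x y {z} x≢z y≢z with ℕₚ.<-cmp x y
... | tri≈ _ refl _ rewrite 𝟙<-no (ℕₚ.≤-refl {x}) | ℕₚ.*-zeroʳ (𝟙 (z <? x)) | ℕₚ.*-zeroʳ (𝟙 (x <? z)) = z≤n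
... | tri< x<y x≢y _ rewrite 𝟙-yes (¬? (x ≟ y)) x≢y = extreme-pair-< x<y (x≢z ∘ sym) (y≢z ∘ sym)
... | tri> _ y≢x y<x rewrite 𝟙-yes (¬? (x ≟ y)) y≢x =
  subst₂ _≤_ (ℕₚ.+-comm (extreme y x z) (extreme x y z)) (cong suc (ℕₚ.+-comm (between y z x) (between x z y)))
    (extreme-pair-< y<x (y≢z ∘ sym) (x≢z ∘ sym))

⌊a+a+d/2⌋ : ∀ a d → ⌊ a + a + d /2⌋ ≡ a + ⌊ d /2⌋
⌊a+a+d/2⌋ zero    d = refl
⌊a+a+d/2⌋ (suc a) d rewrite ℕₚ.+-suc a a = cong suc (⌊a+a+d/2⌋ a d)

⌈a+a+d/2⌉ : ∀ a d → ⌈ a + a + d /2⌉ ≡ a + ⌈ d /2⌉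
⌈a+a+d/2⌉ a d = trans (cong ⌊_/2⌋ (sym (ℕₚ.+-suc (a + a) d))) (⌊a+a+d/2⌋ a (suc d))

*-≤-⌊/2⌋*⌈/2⌉-ordered : ∀ {a b} → a ≤ b → a * b ≤ ⌊ a + b /2⌋ * ⌈ a + b /2⌉
*-≤-⌊/2⌋*⌈/2⌉-ordered {a} a≤b with ℕₚ.m≤n⇒∃[o]m+o≡n a≤b
... | d , refl = begin
  a * (a + d)                                         ≤⟨ ℕₚ.m≤m+n (a * (a + d)) (⌊ d /2⌋ * ⌈ d /2⌉) ⟩
  a * (a + d) + ⌊ d /2⌋ * ⌈ d /2⌉
    ≡⟨ cong (λ e → a * (a + e) + ⌊ d /2⌋ * ⌈ d /2⌉) (ℕₚ.⌊n/2⌋+⌈n/2⌉≡n d) ⟨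
  a * (a + (⌊ d /2⌋ + ⌈ d /2⌉)) + ⌊ d /2⌋ * ⌈ d /2⌉   ≡⟨ expand a ⌊ d /2⌋ ⌈ d /2⌉ ⟩
  (a + ⌊ d /2⌋) * (a + ⌈ d /2⌉)                       ≡⟨ cong₂ _*_ (⌊a+a+d/2⌋ a d) (⌈a+a+d/2⌉ a d) ⟨
  ⌊ a + a + d /2⌋ * ⌈ a + a + d /2⌉                   ≡⟨ cong (λ k → ⌊ k /2⌋ * ⌈ k /2⌉) (ℕₚ.+-assoc a a d) ⟩
  ⌊ a + (a + d) /2⌋ * ⌈ a + (a + d) /2⌉               ∎
  where
  open ℕₚ.≤-Reasoning
  expand : ∀ a p q → a * (a + (p + q)) + p * q ≡ (a + p) * (a + q)
  expand = solve-∀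

*-≤-⌊/2⌋*⌈/2⌉ : ∀ a b → a * b ≤ ⌊ a + b /2⌋ * ⌈ a + b /2⌉
*-≤-⌊/2⌋*⌈/2⌉ a b with ℕₚ.≤-total a b
... | inj₁ a≤b = *-≤-⌊/2⌋*⌈/2⌉-ordered a≤b
... | inj₂ b≤a = subst₂ (λ p s → p ≤ ⌊ s /2⌋ * ⌈ s /2⌉) (ℕₚ.*-comm b a) (ℕₚ.+-comm b a)
                   (*-≤-⌊/2⌋*⌈/2⌉-ordered b≤a)

offDiagonal : ℕ → ℕ
offDiagonal n = ∑[ i < n ] ∑[ j < n ] 𝟙 (¬? (i Finₚ.≟ j))

offDiagonal+n : ∀ n → offDiagonal n + n ≡ n * n
offDiagonal+n n = begin
  offDiagonal n + n                        ≡⟨ cong (offDiagonal n +_) (trans (∑-const n 1) (ℕₚ.*-identityʳ n)) ⟨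
  offDiagonal n + ∑[ i < n ] 1             ≡⟨ ∑-distrib-+ (λ i → ∑[ j < n ] differ i j) (λ _ → 1) ⟨
  ∑[ i < n ] (∑[ j < n ] differ i j + 1)   ≡⟨ ∑-cong row ⟩
  ∑[ i < n ] n                             ≡⟨ ∑-const n n ⟩
  n * n                                    ∎
  where
  open ≡-Reasoning
  same differ : Fin n → Fin n → ℕ
  same i j = 𝟙 (i Finₚ.≟ j)
  differ i j = 𝟙 (¬? (i Finₚ.≟ j))
  row : ∀ i → ∑[ j < n ] differ i j + 1 ≡ n
  row i = begin
    ∑[ j < n ] differ i j + 1                     ≡⟨ cong (∑[ j < n ] differ i j +_) (∑-δ i) ⟨
    ∑[ j < n ] differ i j + ∑[ j < n ] same i j   ≡⟨ ∑-distrib-+ (differ i) (same i) ⟨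
    ∑[ j < n ] (differ i j + same i j)            ≡⟨ ∑-cong (λ j → trans (ℕₚ.+-comm (differ i j) _) (𝟙-¬ (i Finₚ.≟ j))) ⟩
    ∑[ j < n ] 1                                  ≡⟨ ∑-const n 1 ⟩
    n * 1                                         ≡⟨ ℕₚ.*-identityʳ n ⟩
    n                                             ∎

4*suc∸2 : ∀ p → 4 * suc p ∸ 2 ≡ 2 + 4 * p
4*suc∸2 p = trans (cong (_∸ 2) (expand p)) (ℕₚ.m+n∸m≡n 2 (2 + 4 * p))
  where
  expand : ∀ p → 4 * suc p ≡ 2 + (2 + 4 * p)
  expand = solve-∀

3*suc∸1 : ∀ p → 3 * suc p ∸ 1 ≡ 2 + 3 * p
3*suc∸1 p = trans (cong (_∸ 1) (expand p)) (ℕₚ.m+n∸m≡n 1 (2 + 3 * p))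
  where
  expand : ∀ p → 3 * suc p ≡ 1 + (2 + 3 * p)
  expand = solve-∀

⌈n/2⌉≡⌊n/2⌋⊎1+⌊n/2⌋ : ∀ n → ⌈ n /2⌉ ≡ ⌊ n /2⌋ ⊎ ⌈ n /2⌉ ≡ suc ⌊ n /2⌋
⌈n/2⌉≡⌊n/2⌋⊎1+⌊n/2⌋ zero          = inj₁ refl
⌈n/2⌉≡⌊n/2⌋⊎1+⌊n/2⌋ (suc zero)    = inj₂ refl
⌈n/2⌉≡⌊n/2⌋⊎1+⌊n/2⌋ (suc (suc n)) with ⌈n/2⌉≡⌊n/2⌋⊎1+⌊n/2⌋ n
... | inj₁ e = inj₁ (cong suc e)
... | inj₂ e = inj₂ (cong suc e)

⌊n/2⌋*[4⌈n/2⌉∸2]+n≡n*n : ∀ n → ⌊ n /2⌋ * (4 * ⌈ n /2⌉ ∸ 2) + n ≡ n * n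
⌊n/2⌋*[4⌈n/2⌉∸2]+n≡n*n n = subst (λ s → ⌊ n /2⌋ * (4 * ⌈ n /2⌉ ∸ 2) + s ≡ s * s) (ℕₚ.⌊n/2⌋+⌈n/2⌉≡n n)
  (halves ⌊ n /2⌋ ⌈ n /2⌉ (⌈n/2⌉≡⌊n/2⌋⊎1+⌊n/2⌋ n))
  where
  even : ∀ p → suc p * (2 + 4 * p) + (suc p + suc p) ≡ (suc p + suc p) * (suc p + suc p)
  even = solve-∀
  odd : ∀ k → k * (2 + 4 * k) + (k + suc k) ≡ (k + suc k) * (k + suc k)
  odd = solve-∀
  halves : ∀ k m → m ≡ k ⊎ m ≡ suc k → k * (4 * m ∸ 2) + (k + m) ≡ (k + m) * (k + m)
  halves zero    .zero    (inj₁ refl) = refl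
  halves (suc p) .(suc p) (inj₁ refl) rewrite 4*suc∸2 p = even p
  halves k       .(suc k) (inj₂ refl) rewrite 4*suc∸2 k = odd k

offDiagonal≡⌊n/2⌋*[4⌈n/2⌉∸2] : ∀ n → offDiagonal n ≡ ⌊ n /2⌋ * (4 * ⌈ n /2⌉ ∸ 2)
offDiagonal≡⌊n/2⌋*[4⌈n/2⌉∸2] n =
  ℕₚ.+-cancelʳ-≡ n _ _ (trans (offDiagonal+n n) (sym (⌊n/2⌋*[4⌈n/2⌉∸2]+n≡n*n n)))

k[4m∸2]+2km≡2k[3m∸1] : ∀ k m → k * (4 * m ∸ 2) + 2 * (k * m) ≡ 2 * k * (3 * m ∸ 1)
k[4m∸2]+2km≡2k[3m∸1] k zero = atZero k
  where
  atZero : ∀ k → k * 0 + 2 * (k * 0) ≡ 2 * k * 0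
  atZero = solve-∀
k[4m∸2]+2km≡2k[3m∸1] k (suc p) rewrite 4*suc∸2 p | 3*suc∸1 p = atSuc k p
  where
  atSuc : ∀ k p → k * (2 + 4 * p) + 2 * (k * suc p) ≡ 2 * k * (2 + 3 * p)
  atSuc = solve-∀

cancel-2k : ∀ k m t l → 1 ≤ k →
  2 * (t * (k * (4 * m ∸ 2))) ≤ l * (k * (4 * m ∸ 2) + 2 * (k * m)) → (4 * m ∸ 2) * t ≤ (3 * m ∸ 1) * l
cancel-2k (suc k) m t l _ h = ℕₚ.*-cancelˡ-≤ (2 * suc k) (begin
  2 * suc k * (A * t)                     ≡⟨ shuffleˡ (suc k) A t ⟩
  2 * (t * (suc k * A))                   ≤⟨ h ⟩
  l * (suc k * A + 2 * (suc k * m))       ≡⟨ cong (l *_) (k[4m∸2]+2km≡2k[3m∸1] (suc k) m) ⟩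
  l * (2 * suc k * B)                     ≡⟨ shuffleʳ (suc k) B l ⟩
  2 * suc k * (B * l)                     ∎)
  where
  open ℕₚ.≤-Reasoning
  A B : ℕ
  A = 4 * m ∸ 2
  B = 3 * m ∸ 1
  shuffleˡ : ∀ k a t → 2 * k * (a * t) ≡ 2 * (t * (k * a))
  shuffleˡ = solve-∀
  shuffleʳ : ∀ k b l → l * (2 * k * b) ≡ 2 * k * (b * l)
  shuffleʳ = solve-∀

module LowerBound (n : ℕ) where

  private
    N : ℕ
    N = suc (n + n)

  open Branches n

  crossings : Ordering N → ℕ
  crossings = separationsIn (λ i _ → centreEdge i) (λ _ j → outerEdge j)

  totalCrossings : List (Ordering N) → ℕ
  totalCrossings = totalSepCount (λ i _ → centreEdge i) (λ _ j → outerEdge j)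

  module _ (σ : Ordering N) where

    private
      z : ℕ
      z = toℕ (pos σ Fin.zero)

      x : Fin n → ℕ
      x i = toℕ (pos σ (mid i))

      x≢z : ∀ i → x i ≢ z
      x≢z i e with pos-injective σ (Finₚ.toℕ-injective e)
      ... | ()

      separated⇒extreme : ∀ i j → 𝟙 (separates? σ (centreEdge i) (outerEdge j)) ≤ extreme (x i) (x j) z
      separated⇒extreme i j = subst (𝟙 (separates? σ (centreEdge i) (outerEdge j)) ≤_)
        (cong₂ _+_ (𝟙-× (z <? x j) (x i <? x j)) (𝟙-× (x j <? z) (x j <? x i)))
        (𝟙-⊎ (separates? σ (centreEdge i) (outerEdge j)) ((z <? x j) ×-dec (x i <? x j))
             ((x j <? z) ×-dec (x j <? x i)) outerMidOutside)
        where
        outerMidOutside : Separated σ (centreEdge i) (outerEdge j) → (z < x j × x i < x j) ⊎ (x j < z × x j < x i)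
        outerMidOutside (inj₁ ((z<xj , _) , (xi<xj , _))) = inj₁ (z<xj , xi<xj)
        outerMidOutside (inj₂ ((xj<z , xj<xi) , _))       = inj₂ (xj<z , xj<xi)

      before after : ℕ
      before = ∑[ i < n ] 𝟙 (x i <? z)
      after  = ∑[ j < n ] 𝟙 (z <? x j)

      before+after : before + after ≡ n
      before+after = begin
        before + after                              ≡⟨ ∑-distrib-+ (λ i → 𝟙 (x i <? z)) (λ i → 𝟙 (z <? x i)) ⟨
        ∑[ i < n ] (𝟙 (x i <? z) + 𝟙 (z <? x i))    ≡⟨ ∑-cong oneSide ⟩
        ∑[ i < n ] 1                                ≡⟨ ∑-const n 1 ⟩
        n * 1                                       ≡⟨ ℕₚ.*-identityʳ n ⟩
        n                                           ∎
        where
        open ≡-Reasoning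
        oneSide : ∀ i → 𝟙 (x i <? z) + 𝟙 (z <? x i) ≡ 1
        oneSide i with ℕₚ.<-cmp (x i) z
        ... | tri< xi<z _ _ rewrite 𝟙<-yes xi<z | 𝟙<-no (ℕₚ.<⇒≤ xi<z) = refl
        ... | tri≈ _ xi≡z _ = ⊥-elim (x≢z i xi≡z)
        ... | tri> _ _ z<xi rewrite 𝟙<-yes z<xi | 𝟙<-no (ℕₚ.<⇒≤ z<xi) = refl

      ∑∑-between : ∑[ i < n ] ∑[ j < n ] between (x i) z (x j) ≡ before * after
      ∑∑-between = begin
        ∑[ i < n ] ∑[ j < n ] (𝟙 (x i <? z) * 𝟙 (z <? x j))
          ≡⟨ ∑-cong (λ i → *-distribˡ-sum (𝟙 (x i <? z)) (λ j → 𝟙 (z <? x j))) ⟨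
        ∑[ i < n ] (𝟙 (x i <? z) * after)                  ≡⟨ *-distribʳ-sum after (λ i → 𝟙 (x i <? z)) ⟨
        before * after                                     ∎
        where open ≡-Reasoning

    crossings-bound : 2 * crossings σ ≤ offDiagonal n + 2 * (⌊ n /2⌋ * ⌈ n /2⌉)
    crossings-bound = begin
      2 * crossings σ
        ≡⟨ cong (crossings σ +_) (ℕₚ.+-identityʳ _) ⟩
      crossings σ + crossings σ
        ≡⟨ cong (crossings σ +_) (∑-comm sep) ⟩
      ∑[ i < n ] ∑[ j < n ] sep i j + ∑[ i < n ] ∑[ j < n ] sep j i
        ≡⟨ ∑∑-distrib-+ sep (λ i j → sep j i) ⟨
      ∑[ i < n ] ∑[ j < n ] (sep i j + sep j i)
        ≤⟨ ∑∑-mono (λ i j → ℕₚ.+-mono-≤ (separated⇒extreme i j) (separated⇒extreme j i)) ⟩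
      ∑[ i < n ] ∑[ j < n ] (extreme (x i) (x j) z + extreme (x j) (x i) z)
        ≤⟨ ∑∑-mono (λ i j → ℕₚ.≤-trans (extreme-pair (x i) (x j) (x≢z i) (x≢z j)) (positions-distinct i j)) ⟩
      ∑[ i < n ] ∑[ j < n ] (𝟙 (¬? (i Finₚ.≟ j)) + (B i j + B j i))
        ≡⟨ ∑∑-distrib-+ (λ i j → 𝟙 (¬? (i Finₚ.≟ j))) (λ i j → B i j + B j i) ⟩
      offDiagonal n + ∑[ i < n ] ∑[ j < n ] (B i j + B j i)
        ≡⟨ cong (offDiagonal n +_) (∑∑-distrib-+ B (λ i j → B j i)) ⟩
      offDiagonal n + (∑[ i < n ] ∑[ j < n ] B i j + ∑[ i < n ] ∑[ j < n ] B j i)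
        ≡⟨ cong (λ s → offDiagonal n + (∑[ i < n ] ∑[ j < n ] B i j + s)) (∑-comm B) ⟨
      offDiagonal n + (∑[ i < n ] ∑[ j < n ] B i j + ∑[ i < n ] ∑[ j < n ] B i j)
        ≡⟨ cong (λ s → offDiagonal n + (s + s)) ∑∑-between ⟩
      offDiagonal n + (before * after + before * after)
        ≤⟨ ℕₚ.+-monoʳ-≤ (offDiagonal n) (ℕₚ.+-mono-≤ balanced balanced) ⟩
      offDiagonal n + (M + M)
        ≡⟨ cong (λ s → offDiagonal n + (M + s)) (ℕₚ.+-identityʳ M) ⟨
      offDiagonal n + 2 * M
        ∎
      where
      open ℕₚ.≤-Reasoning
      M : ℕ
      M = ⌊ n /2⌋ * ⌈ n /2⌉
      sep B : Fin n → Fin n → ℕ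
      sep i j = 𝟙 (separates? σ (centreEdge i) (outerEdge j))
      B i j = between (x i) z (x j)
      positions-distinct : ∀ i j → 𝟙 (¬? (x i ≟ x j)) + (B i j + B j i) ≤ 𝟙 (¬? (i Finₚ.≟ j)) + (B i j + B j i)
      positions-distinct i j = ℕₚ.+-monoˡ-≤ _ (𝟙-mono (¬? (x i ≟ x j)) (¬? (i Finₚ.≟ j)) (λ xi≢xj → xi≢xj ∘ cong x))
      balanced : before * after ≤ M
      balanced = subst (λ s → before * after ≤ ⌊ s /2⌋ * ⌈ s /2⌉) before+after (*-≤-⌊/2⌋*⌈/2⌉ before after)

  separatesAll⇒totalCrossings : ∀ {L t} → SeparatesAll (SubdividedStar n) L t → t * offDiagonal n ≤ totalCrossings L
  separatesAll⇒totalCrossings {L} {t} separated = begin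
    t * offDiagonal n                                       ≡⟨ *-distribˡ-∑∑ {n} {n} t (λ i j → 𝟙 (¬? (i Finₚ.≟ j))) ⟩
    ∑[ i < n ] ∑[ j < n ] (t * 𝟙 (¬? (i Finₚ.≟ j)))         ≤⟨ ∑∑-mono {n} {n} pair ⟩
    totalCrossings L                                        ∎
    where
    open ℕₚ.≤-Reasoning
    pair : ∀ i j → t * 𝟙 (¬? (i Finₚ.≟ j)) ≤ sepCount L (centreEdge i) (outerEdge j)
    pair i j with i Finₚ.≟ j
    ... | yes refl rewrite ℕₚ.*-zeroʳ t = z≤n
    ... | no i≢j rewrite ℕₚ.*-identityʳ t =
      separated Fin.zero (mid i) (mid j) (leaf j) (cm i) (ml j) (centre-outer-nonincident i≢j)

  doubled-lower-bound : ∀ {L t} → SeparatesAll (SubdividedStar n) L t →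
    2 * (t * offDiagonal n) ≤ length L * (offDiagonal n + 2 * (⌊ n /2⌋ * ⌈ n /2⌉))
  doubled-lower-bound {L} separated = ℕₚ.≤-trans (ℕₚ.*-monoʳ-≤ 2 (separatesAll⇒totalCrossings {L} separated))
    (totalSepCount-bound (λ i _ → centreEdge i) (λ _ j → outerEdge j) 2
      (offDiagonal n + 2 * (⌊ n /2⌋ * ⌈ n /2⌉)) crossings-bound L)

  lowerBound : 2 ≤ n → ∀ {L t} → SeparatesAll (SubdividedStar n) L t →
    (4 * ⌈ n /2⌉ ∸ 2) * t ≤ (3 * ⌈ n /2⌉ ∸ 1) * length L
  lowerBound 2≤n {L} {t} separated = cancel-2k ⌊ n /2⌋ ⌈ n /2⌉ t (length L) (ℕₚ.⌊n/2⌋-mono 2≤n)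
    (subst (λ D → 2 * (t * D) ≤ length L * (D + 2 * (⌊ n /2⌋ * ⌈ n /2⌉)))
      (offDiagonal≡⌊n/2⌋*[4⌈n/2⌉∸2] n) (doubled-lower-bound {L} separated))

-- Words with prescribed numbers of letters

Word : Set
Word = List Bool

letter : Word → ℕ → Bool
letter []      _       = false
letter (b ∷ _) zero    = b
letter (_ ∷ w) (suc i) = letter w i

words : ℕ → ℕ → List Word
words zero    zero    = [] ∷ []
words zero    (suc b) = map (false ∷_) (words zero b)
words (suc a) zero    = map (true ∷_) (words a zero)
words (suc a) (suc b) = map (true ∷_) (words a (suc b)) ++ map (false ∷_) (words (suc a) b)

#words : ℕ → ℕ → ℕ
#words a b = length (words a b)

#words-suc-suc : ∀ a b → #words (suc a) (suc b) ≡ #words a (suc b) + #words (suc a) b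
#words-suc-suc a b = trans (Listₚ.length-++ (map (true ∷_) (words a (suc b))))
  (cong₂ _+_ (Listₚ.length-map (true ∷_) (words a (suc b))) (Listₚ.length-map (false ∷_) (words (suc a) b)))

#words-zeroʳ : ∀ a → #words a zero ≡ 1
#words-zeroʳ zero    = refl
#words-zeroʳ (suc a) = trans (Listₚ.length-map (true ∷_) (words a zero)) (#words-zeroʳ a)

#words-zeroˡ : ∀ b → #words zero b ≡ 1
#words-zeroˡ zero    = refl
#words-zeroˡ (suc b) = trans (Listₚ.length-map (false ∷_) (words zero b)) (#words-zeroˡ b)

#words-comm : ∀ a b → #words a b ≡ #words b a
#words-comm zero    b       = trans (#words-zeroˡ b) (sym (#words-zeroʳ b))
#words-comm (suc a) zero    = trans (#words-zeroʳ (suc a)) (sym (#words-zeroˡ (suc a)))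
#words-comm (suc a) (suc b) = begin
  #words (suc a) (suc b)                 ≡⟨ #words-suc-suc a b ⟩
  #words a (suc b) + #words (suc a) b    ≡⟨ cong₂ _+_ (#words-comm a (suc b)) (#words-comm (suc a) b) ⟩
  #words (suc b) a + #words b (suc a)    ≡⟨ ℕₚ.+-comm (#words (suc b) a) _ ⟩
  #words b (suc a) + #words (suc b) a    ≡⟨ #words-suc-suc b a ⟨
  #words (suc b) (suc a)                 ∎
  where open ≡-Reasoning

#words-oneʳ : ∀ a → #words a 1 ≡ suc a
#words-oneʳ zero    = refl
#words-oneʳ (suc a) = trans (#words-suc-suc a 0)
  (trans (cong₂ _+_ (#words-oneʳ a) (#words-zeroʳ (suc a))) (ℕₚ.+-comm (suc a) 1))

#words-absorb : ∀ a b → suc a * #words (suc a) b ≡ suc b * #words a (suc b)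
#words-absorb zero b
  rewrite #words-comm 1 b | #words-oneʳ b | #words-zeroˡ (suc b) =
    trans (ℕₚ.+-identityʳ (suc b)) (sym (ℕₚ.*-identityʳ (suc b)))
#words-absorb (suc a) zero
  rewrite #words-zeroʳ (suc (suc a)) | #words-oneʳ (suc a) =
    trans (ℕₚ.*-identityʳ (suc (suc a))) (sym (ℕₚ.+-identityʳ (suc (suc a))))
#words-absorb (suc a) (suc b) = begin
  suc (suc a) * #words (suc (suc a)) (suc b)                      ≡⟨ cong (suc (suc a) *_) (#words-suc-suc (suc a) b) ⟩
  suc (suc a) * (Y + #words (suc (suc a)) b)                      ≡⟨ ℕₚ.*-distribˡ-+ (suc (suc a)) Y _ ⟩
  suc (suc a) * Y + suc (suc a) * #words (suc (suc a)) b          ≡⟨ cong (suc (suc a) * Y +_) (#words-absorb (suc a) b) ⟩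
  suc (suc a) * Y + suc b * Y                                     ≡⟨ shift a b Y ⟩
  suc a * Y + suc (suc b) * Y                                     ≡⟨ cong (_+ suc (suc b) * Y) (#words-absorb a (suc b)) ⟩
  suc (suc b) * #words a (suc (suc b)) + suc (suc b) * Y          ≡⟨ ℕₚ.*-distribˡ-+ (suc (suc b)) (#words a (suc (suc b))) Y ⟨
  suc (suc b) * (#words a (suc (suc b)) + Y)                      ≡⟨ cong (suc (suc b) *_) (#words-suc-suc a (suc b)) ⟨
  suc (suc b) * #words (suc a) (suc (suc b))                      ∎
  where
  open ≡-Reasoning
  Y : ℕ
  Y = #words (suc a) (suc b)
  shift : ∀ a b y → suc (suc a) * y + suc b * y ≡ suc a * y + suc (suc b) * y
  shift = solve-∀

1≤#words : ∀ a b → 1 ≤ #words a b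
1≤#words zero    zero    = ℕₚ.≤-refl
1≤#words zero    (suc b) = ℕₚ.≤-reflexive (sym (#words-zeroˡ (suc b)))
1≤#words (suc a) zero    = ℕₚ.≤-reflexive (sym (#words-zeroʳ (suc a)))
1≤#words (suc a) (suc b) = ℕₚ.≤-trans (1≤#words a (suc b))
  (ℕₚ.≤-trans (ℕₚ.m≤m+n _ (#words (suc a) b)) (ℕₚ.≤-reflexive (sym (#words-suc-suc a b))))

count-words-suc-suc : ∀ (p : Word → Bool) a b → count p (words (suc a) (suc b)) ≡
  count (p ∘ (true ∷_)) (words a (suc b)) + count (p ∘ (false ∷_)) (words (suc a) b)
count-words-suc-suc p a b = trans (count-++ p (map (true ∷_) (words a (suc b))) _)
  (cong₂ _+_ (count-map p (true ∷_) (words a (suc b))) (count-map p (false ∷_) (words (suc a) b)))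

-- #words₋₁ a b (resp. #words₋₂ a b) counts the words of words a b with one (resp. two) prescribed letters true
#words₋₁ #words₋₂ : ℕ → ℕ → ℕ
#words₋₁ zero    b = 0
#words₋₁ (suc a) b = #words a b
#words₋₂ zero    b = 0
#words₋₂ (suc a) b = #words₋₁ a b

#words₋₁-suc-suc : ∀ a b → #words₋₁ (suc a) (suc b) ≡ #words₋₁ a (suc b) + #words₋₁ (suc a) b
#words₋₁-suc-suc zero    b = trans (#words-zeroˡ (suc b)) (sym (#words-zeroˡ b))
#words₋₁-suc-suc (suc a) b = #words-suc-suc a b

#words₋₂-suc-suc : ∀ a b → #words₋₂ (suc a) (suc b) ≡ #words₋₂ a (suc b) + #words₋₂ (suc a) b
#words₋₂-suc-suc zero    b = refl
#words₋₂-suc-suc (suc a) b = #words₋₁-suc-suc a b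

count-letter : ∀ j a b → j < a + b → count (λ w → letter w j) (words a b) ≡ #words₋₁ a b
count-letter zero    zero          (suc b) _ = trans (count-map _ (false ∷_) (words zero b)) (count-false (words zero b))
count-letter zero    (suc a)       zero    _ = trans (count-map _ (true ∷_) (words a zero)) (count-true (words a zero))
count-letter zero    (suc a)       (suc b) _ = trans (count-words-suc-suc _ a b)
  (trans (cong₂ _+_ (count-true (words a (suc b))) (count-false (words (suc a) b))) (ℕₚ.+-identityʳ _))
count-letter (suc j) zero          (suc b) (s≤s j<b) = trans (count-map _ (false ∷_) (words zero b)) (count-letter j zero b j<b)
count-letter (suc j) (suc (suc a)) zero    (s≤s j<a) = trans (count-map _ (true ∷_) (words (suc a) zero))
  (trans (count-letter j (suc a) zero j<a) (trans (#words-zeroʳ a) (sym (#words-zeroʳ (suc a)))))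
count-letter (suc j) (suc a)       (suc b) (s≤s j<) = trans (count-words-suc-suc _ a b)
  (trans (cong₂ _+_ (count-letter j a (suc b) j<) (count-letter j (suc a) b (subst (j <_) (ℕₚ.+-suc a b) j<)))
    (sym (#words₋₁-suc-suc a b)))

count-letter-pair : ∀ i j a b → i < j → j < a + b → count (λ w → letter w i ∧ letter w j) (words a b) ≡ #words₋₂ a b
count-letter-pair zero    (suc j) zero          (suc b) _         _         =
  trans (count-map _ (false ∷_) (words zero b)) (count-false (words zero b))
count-letter-pair zero    (suc j) (suc a)       zero    _         (s≤s j<a) =
  trans (count-map _ (true ∷_) (words a zero)) (count-letter j a zero j<a)
count-letter-pair zero    (suc j) (suc a)       (suc b) _         (s≤s j<) = trans (count-words-suc-suc _ a b)
  (trans (cong₂ _+_ (count-letter j a (suc b) j<) (count-false (words (suc a) b))) (ℕₚ.+-identityʳ _))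
count-letter-pair (suc i) (suc j) zero          (suc b) (s≤s i<j) (s≤s j<b) =
  trans (count-map _ (false ∷_) (words zero b)) (count-letter-pair i j zero b i<j j<b)
count-letter-pair (suc i) (suc j) (suc (suc zero)) zero (s≤s i<j) (s≤s (s≤s j≤0)) =
  ⊥-elim (ℕₚ.<⇒≱ i<j (ℕₚ.≤-trans j≤0 z≤n))
count-letter-pair (suc i) (suc j) (suc (suc (suc a))) zero (s≤s i<j) (s≤s j<a) =
  trans (count-map _ (true ∷_) (words (suc (suc a)) zero))
    (trans (count-letter-pair i j (suc (suc a)) zero i<j j<a) (trans (#words-zeroʳ a) (sym (#words-zeroʳ (suc a)))))
count-letter-pair (suc i) (suc j) (suc a)       (suc b) (s≤s i<j) (s≤s j<) = trans (count-words-suc-suc _ a b)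
  (trans (cong₂ _+_ (count-letter-pair i j a (suc b) i<j j<)
                    (count-letter-pair i j (suc a) b i<j (subst (j <_) (ℕₚ.+-suc a b) j<)))
    (sym (#words₋₂-suc-suc a b)))

count-not-letter-pair : ∀ i j m → i < j → j < m + m →
  count (λ w → not (letter w i) ∧ not (letter w j)) (words m m) ≡ #words₋₂ m m
count-not-letter-pair i j (suc m) i<j j<2m = ℕₚ.+-cancelʳ-≡ (W₁ + W₁) _ _ (begin
  c + (W₁ + W₁)                             ≡⟨ ℕₚ.+-assoc c W₁ W₁ ⟨
  c + W₁ + W₁                               ≡⟨ cong₂ (λ u v → c + u + v) (count-letter i (suc m) (suc m) (ℕₚ.<-trans i<j j<2m))
                                                                         (count-letter j (suc m) (suc m) j<2m) ⟨
  c + count (letterAt i) ws + count (letterAt j) ws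
    ≡⟨ count-inclusion-exclusion _ _ _ _ exclusion ws ⟩
  #words (suc m) (suc m) + count (λ w → letter w i ∧ letter w j) ws
    ≡⟨ cong₂ _+_ halves (count-letter-pair i j (suc m) (suc m) i<j j<2m) ⟩
  (W₁ + W₁) + #words₋₂ (suc m) (suc m)      ≡⟨ ℕₚ.+-comm (W₁ + W₁) _ ⟩
  #words₋₂ (suc m) (suc m) + (W₁ + W₁)      ∎)
  where
  open ≡-Reasoning
  ws : List Word
  ws = words (suc m) (suc m)
  letterAt : ℕ → Word → Bool
  letterAt k w = letter w k
  c W₁ : ℕ
  c = count (λ w → not (letter w i) ∧ not (letter w j)) ws
  W₁ = #words₋₁ (suc m) (suc m)
  exclusion : ∀ w → bit (not (letter w i) ∧ not (letter w j)) + bit (letter w i) + bit (letter w j) ≡ 1 + bit (letter w i ∧ letter w j)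
  exclusion w with letter w i | letter w j
  ... | true  | true  = refl
  ... | true  | false = refl
  ... | false | true  = refl
  ... | false | false = refl
  halves : #words (suc m) (suc m) ≡ W₁ + W₁
  halves = trans (#words-suc-suc m m) (cong (W₁ +_) (#words-comm (suc m) m))

#words-central : ∀ p → suc p * #words (2 + p) (2 + p) ≡ (2 + 4 * suc p) * #words p (2 + p)
#words-central p = begin
  suc p * #words (2 + p) (2 + p)         ≡⟨ cong (suc p *_) (trans (#words-suc-suc (suc p) (suc p))
                                                                  (cong (X +_) (#words-comm (2 + p) (suc p)))) ⟩
  suc p * (X + X)                        ≡⟨ cong (λ x → suc p * (x + x)) (#words-suc-suc p (suc p)) ⟩
  suc p * ((A + Y) + (A + Y))            ≡⟨ expand p A Y ⟩
  2 * (suc p * A) + 2 * (suc p * Y)      ≡⟨ cong (λ y → 2 * (suc p * A) + 2 * y) (#words-absorb p (suc p)) ⟩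
  2 * (suc p * A) + 2 * ((2 + p) * A)    ≡⟨ collect p A ⟩
  (2 + 4 * suc p) * A                    ∎
  where
  open ≡-Reasoning
  A X Y : ℕ
  A = #words p (2 + p)
  X = #words (suc p) (2 + p)
  Y = #words (suc p) (suc p)
  expand : ∀ p a y → suc p * ((a + y) + (a + y)) ≡ 2 * (suc p * a) + 2 * (suc p * y)
  expand = solve-∀
  collect : ∀ p a → 2 * (suc p * a) + 2 * ((2 + p) * a) ≡ (2 + 4 * suc p) * a
  collect = solve-∀

#words₋₂<#words : ∀ m → #words₋₂ m m < #words m m
#words₋₂<#words zero          = s≤s z≤n
#words₋₂<#words (suc zero)    = s≤s z≤n
#words₋₂<#words (suc (suc p)) = begin-strict
  #words p (2 + p)                                ≡⟨ ℕₚ.+-identityʳ _ ⟨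
  #words p (2 + p) + 0                            <⟨ ℕₚ.+-monoʳ-< (#words p (2 + p)) (1≤#words (suc p) (suc p)) ⟩
  #words p (2 + p) + #words (suc p) (suc p)       ≡⟨ #words-suc-suc p (suc p) ⟨
  #words (suc p) (2 + p)                          ≤⟨ ℕₚ.m≤m+n _ _ ⟩
  #words (suc p) (2 + p) + #words (2 + p) (suc p) ≡⟨ #words-suc-suc (suc p) (suc p) ⟨
  #words (2 + p) (2 + p)                          ∎
  where open ℕₚ.≤-Reasoning

-- #words a b = C(a + b, a), so this reads (3m - 1) C(2m, m) = (4m - 2) (C(2m, m) - C(2m - 2, m - 2)).
#words-identity : ∀ m → 1 ≤ m → (3 * m ∸ 1) * #words m m ≡ (4 * m ∸ 2) * (#words m m ∸ #words₋₂ m m)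
#words-identity (suc zero)    _ = refl
#words-identity (suc (suc p)) _ = trans (cong₂ _*_ (3*suc∸1 (suc p)) refl) (trans core (cong₂ _*_ (sym (4*suc∸2 (suc p))) refl))
  where
  open ≡-Reasoning
  W A : ℕ
  W = #words (2 + p) (2 + p)
  A = #words p (2 + p)
  A≤W : A ≤ W
  A≤W = ℕₚ.<⇒≤ (#words₋₂<#words (2 + p))
  split : ∀ p w → (2 + 3 * suc p) * w + suc p * w ≡ (2 + 4 * suc p) * w
  split = solve-∀
  core : (2 + 3 * suc p) * W ≡ (2 + 4 * suc p) * (W ∸ A)
  core = ℕₚ.+-cancelʳ-≡ (suc p * W) _ _ (begin
    (2 + 3 * suc p) * W + suc p * W                 ≡⟨ split p W ⟩
    (2 + 4 * suc p) * W                             ≡⟨ cong ((2 + 4 * suc p) *_) (ℕₚ.m∸n+n≡m A≤W) ⟨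
    (2 + 4 * suc p) * (W ∸ A + A)                   ≡⟨ ℕₚ.*-distribˡ-+ (2 + 4 * suc p) (W ∸ A) A ⟩
    (2 + 4 * suc p) * (W ∸ A) + (2 + 4 * suc p) * A ≡⟨ cong ((2 + 4 * suc p) * (W ∸ A) +_) (#words-central p) ⟨
    (2 + 4 * suc p) * (W ∸ A) + suc p * W           ∎)

-- The orderings of the construction

true∧true≢false : ∀ {a b} → a ≡ true → b ≡ true → a ∧ b ≢ false
true∧true≢false refl refl ()

double-< : ∀ {x y} → x < y → suc (x + x) < y + y
double-< {x} {y} x<y = subst (_≤ y + y) (cong suc (ℕₚ.+-suc x x)) (ℕₚ.+-mono-≤ x<y x<y)

module Construction (n : ℕ) where

  open Branches n

  private
    N : ℕ
    N = suc (n + n)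

  -- Branch i gets the keys base w i and base w i + 1: a branch whose letter is true lies below the
  -- centre (key 2n) with its leaf first, a branch whose letter is false lies above it with its mid first.
  base : Word → Fin n → ℕ
  base w i = if letter w (toℕ i) then toℕ i + toℕ i else suc (n + n + (toℕ i + toℕ i))

  branchKey : Word → Fin n ⊎ Fin n → ℕ
  branchKey w (inj₁ i) = if letter w (toℕ i) then suc (base w i) else base w i
  branchKey w (inj₂ i) = if letter w (toℕ i) then base w i else suc (base w i)

  key : Word → Fin N → ℕ
  key w Fin.zero    = n + n
  key w (Fin.suc v) = branchKey w (Fin.splitAt n v)

  opaque
    ordering : Word → Ordering N
    ordering w = sortedBy (key w)

    ordering-mono : ∀ w {u v} → key w u < key w v → pos (ordering w) u Fin.< pos (ordering w) v
    ordering-mono w {u} {v} = sortedBy-mono (key w) {u} {v}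

  module _ (w : Word) where

    key-mid : ∀ i → key w (mid i) ≡ branchKey w (inj₁ i)
    key-mid i = cong (branchKey w) (Finₚ.splitAt-↑ˡ n i n)

    key-leaf : ∀ i → key w (leaf i) ≡ branchKey w (inj₂ i)
    key-leaf i = cong (branchKey w) (Finₚ.splitAt-↑ʳ n n i)

    key-mid-true : ∀ {i} → letter w (toℕ i) ≡ true → key w (mid i) ≡ suc (base w i)
    key-mid-true {i} li rewrite key-mid i | li = refl

    key-mid-false : ∀ {i} → letter w (toℕ i) ≡ false → key w (mid i) ≡ base w i
    key-mid-false {i} li rewrite key-mid i | li = refl

    InBranch : Fin n → ℕ → Set
    InBranch i k = base w i ≤ k × k ≤ suc (base w i)

    mid-inBranch : ∀ i → InBranch i (key w (mid i))
    mid-inBranch i rewrite key-mid i with letter w (toℕ i)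
    ... | true  = ℕₚ.n≤1+n _ , ℕₚ.≤-refl
    ... | false = ℕₚ.≤-refl , ℕₚ.n≤1+n _

    leaf-inBranch : ∀ i → InBranch i (key w (leaf i))
    leaf-inBranch i rewrite key-leaf i with letter w (toℕ i)
    ... | true  = ℕₚ.≤-refl , ℕₚ.n≤1+n _
    ... | false = ℕₚ.n≤1+n _ , ℕₚ.≤-refl

    base-true : ∀ {i} → letter w (toℕ i) ≡ true → base w i ≡ toℕ i + toℕ i
    base-true {i} li rewrite li = refl

    base-false : ∀ {i} → letter w (toℕ i) ≡ false → base w i ≡ suc (n + n + (toℕ i + toℕ i))
    base-false {i} li rewrite li = refl

    true-below-centre : ∀ {i} → letter w (toℕ i) ≡ true → suc (base w i) < n + n
    true-below-centre {i} li rewrite base-true li = double-< (Finₚ.toℕ<n i)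

    centre-below-false : ∀ {i} → letter w (toℕ i) ≡ false → n + n < base w i
    centre-below-false {i} li rewrite base-false li = s≤s (ℕₚ.m≤m+n (n + n) _)

    precedes-branch : ∀ {u v} j → key w u < base w j → key w v < base w j →
      Precedes (ordering w) (u , v) (outerEdge j)
    precedes-branch {u} {v} j u< v< =
      (below u (mid j) u< (mid-inBranch j) , below u (leaf j) u< (leaf-inBranch j)) ,
      (below v (mid j) v< (mid-inBranch j) , below v (leaf j) v< (leaf-inBranch j))
      where
      below : ∀ x y → key w x < base w j → InBranch j (key w y) → pos (ordering w) x Fin.< pos (ordering w) y
      below x y x< (b≤ , _) = ordering-mono w {x} {y} (ℕₚ.<-≤-trans x< b≤)

    branch-precedes : ∀ {u v} j → suc (base w j) < key w u → suc (base w j) < key w v →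
      Precedes (ordering w) (outerEdge j) (u , v)
    branch-precedes {u} {v} j <u <v =
      (above (mid j) u (mid-inBranch j) <u , above (mid j) v (mid-inBranch j) <v) ,
      (above (leaf j) u (leaf-inBranch j) <u , above (leaf j) v (leaf-inBranch j) <v)
      where
      above : ∀ x y → InBranch j (key w x) → suc (base w j) < key w y → pos (ordering w) x Fin.< pos (ordering w) y
      above x y (_ , ≤b) <y = ordering-mono w {x} {y} (ℕₚ.≤-<-trans ≤b <y)

    apart-true : ∀ {i j} → letter w (toℕ i) ≡ true → letter w (toℕ j) ≡ true → toℕ i < toℕ j →
      suc (base w i) < base w j
    apart-true li lj i<j rewrite base-true li | base-true lj = double-< i<j

    apart-false : ∀ {i j} → letter w (toℕ i) ≡ false → letter w (toℕ j) ≡ false → toℕ i < toℕ j →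
      suc (base w i) < base w j
    apart-false {i} {j} li lj i<j rewrite base-false li | base-false lj =
      s≤s (subst (_< n + n + (toℕ j + toℕ j)) (ℕₚ.+-suc (n + n) (toℕ i + toℕ i)) (ℕₚ.+-monoʳ-< (n + n) (double-< i<j)))

    branch-order : ∀ {i j} → suc (base w i) < base w j → Precedes (ordering w) (outerEdge i) (outerEdge j)
    branch-order {i} {j} apart = precedes-branch j (ℕₚ.≤-<-trans (proj₂ (mid-inBranch i)) apart)
                                                   (ℕₚ.≤-<-trans (proj₂ (leaf-inBranch i)) apart)

    outer-separated-< : ∀ {i j} → toℕ i < toℕ j → Separated (ordering w) (outerEdge i) (outerEdge j)
    outer-separated-< {i} {j} i<j with letter w (toℕ i) in li | letter w (toℕ j) in lj
    ... | true  | true  = inj₁ (branch-order (apart-true li lj i<j))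
    ... | true  | false = inj₁ (branch-order (ℕₚ.<-trans (true-below-centre li) (centre-below-false lj)))
    ... | false | true  = inj₂ (branch-order (ℕₚ.<-trans (true-below-centre lj) (centre-below-false li)))
    ... | false | false = inj₁ (branch-order (apart-false li lj i<j))

    outer-separated : ∀ {i j} → i ≢ j → Separated (ordering w) (outerEdge i) (outerEdge j)
    outer-separated {i} {j} i≢j with ℕₚ.<-cmp (toℕ i) (toℕ j)
    ... | tri< i<j _ _ = outer-separated-< i<j
    ... | tri≈ _ i≡j _ = ⊥-elim (i≢j (Finₚ.toℕ-injective i≡j))
    ... | tri> _ _ j<i = separated-sym (ordering w) (outer-separated-< j<i)

    centre-outer-separated : ∀ {i j} →
      (letter w (toℕ i) ≡ true → letter w (toℕ j) ≡ true → toℕ j < toℕ i) →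
      (letter w (toℕ i) ≡ false → letter w (toℕ j) ≡ false → toℕ i < toℕ j) →
      Separated (ordering w) (centreEdge i) (outerEdge j)
    centre-outer-separated {i} {j} bothTrue bothFalse with letter w (toℕ i) in li | letter w (toℕ j) in lj
    ... | true  | true  = inj₂ (branch-precedes j (true-below-centre lj)
      (subst (_ <_) (sym (key-mid-true li)) (ℕₚ.<-trans (apart-true lj li (bothTrue refl refl)) (ℕₚ.n<1+n _))))
    ... | true  | false = inj₁ (precedes-branch j (centre-below-false lj)
      (subst (_< _) (sym (key-mid-true li)) (ℕₚ.<-trans (true-below-centre li) (centre-below-false lj))))
    ... | false | true  = inj₂ (branch-precedes j (true-below-centre lj)
      (subst (_ <_) (sym (key-mid-false li)) (ℕₚ.<-trans (true-below-centre lj) (centre-below-false li))))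
    ... | false | false = inj₁ (precedes-branch j (centre-below-false lj)
      (subst (_< _) (sym (key-mid-false li)) (ℕₚ.<-trans (ℕₚ.n<1+n _) (apart-false li lj (bothFalse refl refl)))))

  m : ℕ
  m = ⌈ n /2⌉

  family : List (Ordering N)
  family = map ordering (words m m)

  guaranteed : ℕ
  guaranteed = #words m m ∸ #words₋₂ m m

  toℕ<m+m : ∀ (i : Fin n) → toℕ i < m + m
  toℕ<m+m i = ℕₚ.<-≤-trans (Finₚ.toℕ<n i)
    (subst (_≤ m + m) (ℕₚ.⌊n/2⌋+⌈n/2⌉≡n n) (ℕₚ.+-monoˡ-≤ m (ℕₚ.⌊n/2⌋≤⌈n/2⌉ n)))

  family-covers : ∀ (p : Word → Bool) {e f} → count p (words m m) ≤ #words₋₂ m m →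
    (∀ w → p w ≡ false → Separated (ordering w) e f) → guaranteed ≤ sepCount family e f
  family-covers p counted separated = ℕₚ.≤-trans (ℕₚ.∸-monoʳ-≤ (#words m m) counted)
    (ℕₚ.m≤n+o⇒m∸n≤o (#words m m) (count p (words m m)) (sepCount-map-≥ ordering p separated (words m m)))

  family-outer : ∀ {i j} → i ≢ j → guaranteed ≤ sepCount family (outerEdge i) (outerEdge j)
  family-outer i≢j = family-covers (λ _ → false) (ℕₚ.≤-trans (ℕₚ.≤-reflexive (count-false (words m m))) z≤n)
    (λ w _ → outer-separated w i≢j)

  family-centre : ∀ {i j} → i ≢ j → guaranteed ≤ sepCount family (centreEdge i) (outerEdge j)
  family-centre {i} {j} i≢j with ℕₚ.<-cmp (toℕ i) (toℕ j)
  ... | tri≈ _ i≡j _ = ⊥-elim (i≢j (Finₚ.toℕ-injective i≡j))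
  ... | tri< i<j _ _ = family-covers (λ w → letter w (toℕ i) ∧ letter w (toℕ j))
    (ℕₚ.≤-reflexive (count-letter-pair (toℕ i) (toℕ j) m m i<j (toℕ<m+m j)))
    (λ w bad → centre-outer-separated w (λ li lj → ⊥-elim (true∧true≢false li lj bad))
                                        (λ _ _ → i<j))
  ... | tri> _ _ j<i = family-covers (λ w → not (letter w (toℕ j)) ∧ not (letter w (toℕ i)))
    (ℕₚ.≤-reflexive (count-not-letter-pair (toℕ j) (toℕ i) m j<i (toℕ<m+m i)))
    (λ w bad → centre-outer-separated w (λ _ _ → j<i)
                                        (λ li lj → ⊥-elim (true∧true≢false (cong not lj) (cong not li) bad)))

  family-separatesAll : SeparatesAll (SubdividedStar n) family guaranteed
  family-separatesAll = separatesAll-fromBranches family guaranteed family-centre family-outer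

  1≤guaranteed : 1 ≤ guaranteed
  1≤guaranteed = ℕₚ.m<n⇒0<n∸m (#words₋₂<#words m)

  family-balance : 1 ≤ m → (3 * m ∸ 1) * length family ≡ (4 * m ∸ 2) * guaranteed
  family-balance 1≤m = trans (cong ((3 * m ∸ 1) *_) (Listₚ.length-map ordering (words m m))) (#words-identity m 1≤m)

-- From the two bounds to the fractional separation dimension

copies : ∀ {A : Set} → ℕ → List A → List A
copies zero    L = []
copies (suc s) L = L ++ copies s L

length-copies : ∀ {A : Set} s (L : List A) → length (copies s L) ≡ s * length L
length-copies zero    L = refl
length-copies (suc s) L = trans (Listₚ.length-++ L) (cong (length L +_) (length-copies s L))

sepCount-copies : ∀ {N} s (L : List (Ordering N)) e f → sepCount (copies s L) e f ≡ s * sepCount L e f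
sepCount-copies zero    L e f = refl
sepCount-copies (suc s) L e f = trans (sepCount-++ L (copies s L) e f) (cong (sepCount L e f +_) (sepCount-copies s L e f))

separatesAll-copies : ∀ {N} {G : Graph N} {L t} s → SeparatesAll G L t → SeparatesAll G (copies s L) (s * t)
separatesAll-copies {L = L} {t} s separated u v x y uv xy disjoint =
  subst (s * t ≤_) (sym (sepCount-copies s L (u , v) (x , y))) (ℕₚ.*-monoʳ-≤ s (separated u v x y uv xy disjoint))

ratio-mono : ∀ a b c d → a * suc d ≤ c * suc b → ratio a (suc b) ℚ.≤ ratio c (suc d)
ratio-mono a b c d le = ℚₚ.toℚᵘ-cancel-≤
  (ℚᵘₚ.≤-respˡ-≃ (ℚᵘₚ.≃-sym (ℚₚ.toℚᵘ-fromℚᵘ (mkℚᵘ (ℤ.+ a) b)))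
    (ℚᵘₚ.≤-respʳ-≃ (ℚᵘₚ.≃-sym (ℚₚ.toℚᵘ-fromℚᵘ (mkℚᵘ (ℤ.+ c) d)))
      (*≤* (subst₂ ℤ._≤_ (ℤₚ.pos-* a (suc d)) (ℤₚ.pos-* c (suc b)) (ℤ.+≤+ le)))))

q-ε<q : ∀ q ε → Positive ε → q ℚ.- ε ℚ.< q
q-ε<q q ε positive = subst (q ℚ.- ε ℚ.<_) (ℚₚ.+-identityʳ q)
  (ℚₚ.+-monoʳ-< q (ℚₚ.neg-antimono-< (ℚₚ.positive⁻¹ ε {{positive}})))

q<q+ε : ∀ q ε → Positive ε → q ℚ.< q ℚ.+ ε
q<q+ε q ε positive = subst (ℚ._< q ℚ.+ ε) (ℚₚ.+-identityʳ q) (ℚₚ.+-monoʳ-< q (ℚₚ.positive⁻¹ ε {{positive}}))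

-- The lower bound holds for every t, and for t = s t₀ the copies of F realise π_t / t = A / B exactly.
fracSepDimIs-fromBounds : ∀ {N} (G : Graph N) A B →
  (∀ {L t} → SeparatesAll G L t → A * t ≤ B * length L) →
  ∀ {F t₀} → SeparatesAll G F t₀ → B * length F ≡ A * t₀ → 1 ≤ t₀ → 1 ≤ B →
  FracSepDimIs G (ratio A B)
fracSepDimIs-fromBounds G A (suc B) lower {F} {t₀} separated balanced 1≤t₀ _ = eventuallyAbove , oftenBelow
  where
  eventuallyAbove : ∀ ε → Positive ε →
    ∃[ T ] ∀ t k → T ≤ t → 1 ≤ t → IsPiT G t k → ratio A (suc B) ℚ.- ε ℚ.< ratio k t
  eventuallyAbove ε positive = 0 , λ { (suc t) k _ _ ((L , refl , separatedL) , _) →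
    ℚₚ.<-≤-trans (q-ε<q (ratio A (suc B)) ε positive)
      (ratio-mono A B (length L) t (subst (A * suc t ≤_) (ℕₚ.*-comm (suc B) (length L)) (lower {L} separatedL))) }

  oftenBelow : ∀ ε → Positive ε → ∀ T →
    ∃[ t ] ∃[ k ] (T ≤ t × 1 ≤ t × IsPiT G t k × ratio k t ℚ.< ratio A (suc B) ℚ.+ ε)
  oftenBelow ε positive T =
    t , k , T≤t , 1≤t , ((copies s F , length-copies s F , separatesAll-copies {L = F} s separated) , minimal) , below
    where
    s t k : ℕ
    s = suc T
    t = s * t₀
    k = s * length F
    s≤t : s ≤ t
    s≤t = ℕₚ.≤-trans (ℕₚ.≤-reflexive (sym (ℕₚ.*-identityʳ s))) (ℕₚ.*-monoʳ-≤ s 1≤t₀)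
    T≤t : T ≤ t
    T≤t = ℕₚ.≤-trans (ℕₚ.n≤1+n T) s≤t
    1≤t : 1 ≤ t
    1≤t = ℕₚ.≤-trans (s≤s z≤n) s≤t
    balanced-k : suc B * k ≡ A * t
    balanced-k = begin
      suc B * (s * length F)   ≡⟨ ℕₚ.*-assoc (suc B) s (length F) ⟨
      suc B * s * length F     ≡⟨ cong (_* length F) (ℕₚ.*-comm (suc B) s) ⟩
      s * suc B * length F     ≡⟨ ℕₚ.*-assoc s (suc B) (length F) ⟩
      s * (suc B * length F)   ≡⟨ cong (s *_) balanced ⟩
      s * (A * t₀)             ≡⟨ ℕₚ.*-assoc s A t₀ ⟨
      s * A * t₀               ≡⟨ cong (_* t₀) (ℕₚ.*-comm s A) ⟩
      A * s * t₀               ≡⟨ ℕₚ.*-assoc A s t₀ ⟩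
      A * t                    ∎
      where open ≡-Reasoning
    minimal : ∀ L → SeparatesAll G L t → k ≤ length L
    minimal L separatedL = ℕₚ.*-cancelˡ-≤ (suc B) (ℕₚ.≤-trans (ℕₚ.≤-reflexive balanced-k) (lower {L} separatedL))
    below : ratio k t ℚ.< ratio A (suc B) ℚ.+ ε
    below with t | 1≤t | balanced-k
    ... | suc t′ | _ | balanced-k′ =
      ℚₚ.≤-<-trans (ratio-mono k t′ A B (ℕₚ.≤-reflexive (trans (ℕₚ.*-comm k (suc B)) balanced-k′)))
                   (q<q+ε (ratio A (suc B)) ε positive)

mainTheorem9 : ∀ (n : ℕ) → 2 ≤ n →
    FracSepDimIs (SubdividedStar n) (ratio (4 * ⌈ n /2⌉ ∸ 2) (3 * ⌈ n /2⌉ ∸ 1))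
mainTheorem9 n 2≤n = fracSepDimIs-fromBounds (SubdividedStar n) (4 * m ∸ 2) (3 * m ∸ 1)
  (λ {L} {t} → LowerBound.lowerBound n 2≤n {L} {t}) {family} family-separatesAll (family-balance 1≤m) 1≤guaranteed 1≤3m∸1
  where
  open Construction n
  1≤m : 1 ≤ m
  1≤m = ℕₚ.⌈n/2⌉-mono 2≤n
  1≤3m∸1 : 1 ≤ 3 * m ∸ 1
  1≤3m∸1 = ℕₚ.≤-trans (s≤s z≤n) (ℕₚ.∸-monoˡ-≤ 1 (ℕₚ.*-monoʳ-≤ 3 1≤m))
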